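{- (1) A relation $R$ on $\{0,1\}$ belongs to $IS_{12}$ if and only if it satisfies the filter property. (2) For $r\ge2$, a relation $R$ on $\{0,1\}$ belongs to $IS^r_{12}$ if and only if it satisfies the $r$-filter property.
   Context: $IS_{12}=\langle\langle\{\mathrm{EQ},\delta_0,\delta_1\}\cup\{\mathrm{OR}^m:m\ge2\}\rangle\rangle$ and $IS^r_{12}=\langle\langle\{\mathrm{EQ},\delta_0,\delta_1\}\cup\{\mathrm{OR}^m:2\le m\le r\}\rangle\rangle$, where $\langle\langle\Gamma\rangle\rangle$ is the smallest set of relations on $\{0,1\}$ containing $\Gamma$ and $\mathrm{EQ}=\{(0,0),(1,1)\}$ closed under manipulations with variables, conjunction and existential quantification; $\delta_0=\{(0)\}$, $\delta_1=\{(1)\}$, $\mathrm{OR}^m=\{0,1\}^m\setminus\{(0,\dots,0)\}$. For an $n$-ary relation $R$: $i\sim_R j$ iff $\mathbf a[i]=\mathbf a[j]$ for all $\mathbf a\in R$ (an equivalence on $[n]$); $O_R$ is the set of $j\in[n]$ such that $\mathbf b[j]=1$ for some $\mathbf b\in R$. A tuple $\mathbf a\in\{0,1\}^n$ is $\sim_R$-conforming if $\mathbf a[i]=\mathbf a[j]$ whenever $i\sim_R j$ and $\mathbf a[i]=0$ whenever $i\notin O_R$; $\le$ is the componentwise order on $\sim_R$-conforming tuples. $R$ has the filter property if for every $\mathbf a\in R$, every $\sim_R$-conforming $\mathbf a'$ with $\mathbf a\le\mathbf a'$ is in $R$. $R$ has the $r$-filter property if it has the filter property and every maximal (w.r.t.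 $\le$) $\sim_R$-conforming tuple not in $R$ has zeros in at most $r$ of the $\sim_R$-classes contained in $O_R$. -}

module Defs where

open import Data.Nat using (ℕ; zero; suc; _≤_)
open import Data.Fin using (Fin; zero; suc)
open import Data.Bool using (Bool; true; false; _∧_; _∨_; not)
import Data.Bool as B
open import Data.Vec.Functional using (Vector; _∷_)
open import Data.Product using (Σ; ∃; _×_; _,_)
open import Relation.Binary.PropositionalEquality using (_≡_; _≢_)
open import Relation.Nullary using (¬_)

-- An n-ary relation on {0,1} (0 = false, 1 = true), given by its
-- characteristic function on tuples a ∈ {0,1}^n.
BRel : ℕ → Set
BRel n = Vector Bool n → Bool

_∈R_ : ∀ {n} → Vector Bool n → BRel n → Set
a ∈R R = R a ≡ true

_≐_ : ∀ {n} → BRel n → BRel n → Set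
R ≐ S = ∀ a → R a ≡ S a

EQ : BRel 2
EQ a = not (a zero B.xor a (suc zero))

δ₀ : BRel 1
δ₀ a = not (a zero)

δ₁ : BRel 1
δ₁ a = a zero

OR : (m : ℕ) → BRel m
OR zero a = false
OR (suc m) a = a zero ∨ OR m (λ i → a (suc i))

-- manipulation of variables (permutation, identification, dummy variables):
-- R' (a) := R (a ∘ σ) for an arbitrary map σ : Fin k → Fin n
substVars : ∀ {k n} → (Fin k → Fin n) → BRel k → BRel n
substVars σ R a = R (λ i → a (σ i))

conj : ∀ {n} → BRel n → BRel n → BRel n
conj R S a = R a ∧ S a

exists : ∀ {n} → BRel (suc n) → BRel n
exists R a = R (false ∷ a) ∨ R (true ∷ a)

-- ⟨⟨{EQ, δ₀, δ₁} ∪ {OR^m : P m}⟩⟩ : smallest set of relations containing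
-- the generators and closed under the above operations (relations being
-- sets of tuples, closure under extensional equality is included).
data Clo (P : ℕ → Set) : ∀ {n} → BRel n → Set where
  gen-EQ : Clo P EQ
  gen-δ₀ : Clo P δ₀
  gen-δ₁ : Clo P δ₁
  gen-OR : ∀ {m} → P m → Clo P (OR m)
  vars   : ∀ {k n} {R : BRel k} (σ : Fin k → Fin n) → Clo P R → Clo P (substVars σ R)
  and    : ∀ {n} {R S : BRel n} → Clo P R → Clo P S → Clo P (conj R S)
  ex     : ∀ {n} {R : BRel (suc n)} → Clo P R → Clo P (exists R)
  ext    : ∀ {n} {R S : BRel n} → Clo P R → R ≐ S → Clo P S

IS12 : ∀ {n} → BRel n → Set
IS12 = Clo (λ m → 2 ≤ m)

IS12^ : ℕ → ∀ {n} → BRel n → Set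
IS12^ r = Clo (λ m → 2 ≤ m × m ≤ r)

_∼[_]_ : ∀ {n} → Fin n → BRel n → Fin n → Set
i ∼[ R ] j = ∀ a → a ∈R R → a i ≡ a j

InO : ∀ {n} → BRel n → Fin n → Set
InO R j = ∃ λ b → b ∈R R × b j ≡ true

Conforming : ∀ {n} → BRel n → Vector Bool n → Set
Conforming R a = (∀ i j → i ∼[ R ] j → a i ≡ a j)
               × (∀ i → ¬ InO R i → a i ≡ false)

_≤t_ : ∀ {n} → Vector Bool n → Vector Bool n → Set
a ≤t a' = ∀ i → a i B.≤ a' i

FilterProperty : ∀ {n} → BRel n → Set
FilterProperty R = ∀ a a' → a ∈R R → Conforming R a' → a ≤t a' → a' ∈R R

MaximalNonMember : ∀ {n} → BRel n → Vector Bool n → Set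
MaximalNonMember R a =
  Conforming R a × R a ≡ false ×
  (∀ a' → Conforming R a' → R a' ≡ false → a ≤t a' → ∀ i → a' i ≡ a i)

-- "a has zeros in at most r of the ∼_R-classes contained in O_R":
-- any family of pairwise ∼_R-inequivalent positions in O_R at which a is 0
-- (i.e. any choice of representatives of distinct such classes) has size ≤ r.
ZeroClassesAtMost : ∀ {n} → ℕ → BRel n → Vector Bool n → Set
ZeroClassesAtMost {n} r R a =
  ∀ k (f : Fin k → Fin n) →
    (∀ p q → p ≢ q → ¬ (f p ∼[ R ] f q)) →
    (∀ p → InO R (f p)) →
    (∀ p → a (f p) ≡ false) →
    k ≤ r

rFilterProperty : ℕ → ∀ {n} → BRel n → Set
rFilterProperty r R =
  FilterProperty R × (∀ a → MaximalNonMember R a → ZeroClassesAtMost r R a)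

-- Both classes are characterised through a clausal normal form.  A tuple a
-- is *refuted* for R by a constraint that holds on every member of R but
-- fails at a: an equality xᵢ = xⱼ, a constant xᵢ = 0, or a positive clause
-- x_{f 1} ∨ … ∨ x_{f k} whose size k is allowed by a predicate Ok.  R is
-- *refutable* if every non-member is refuted.

module Submission where

open import Defs
open import Data.Nat using (ℕ; zero; suc; _≤_; _<_; _+_; z≤n; s≤s; s≤s⁻¹)
open import Data.Nat.Properties using (≤-trans; <-≤-trans; n<1+n; +-mono-≤; +-mono-<-≤; +-mono-≤-<)
open import Data.Fin using (Fin; zero; suc)
import Data.Fin as Fin
open import Data.Fin.Properties using (any?; all?; injective⇒≤)
open import Data.Bool using (Bool; true; false; _∧_; _∨_; not; if_then_else_)
import Data.Bool as B
import Data.Bool.Properties as BP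
open import Data.Vec.Functional using (Vector; _∷_; []; head; tail)
open import Data.List using (List; allFin) renaming ([] to []ᴸ; _∷_ to _∷ᴸ_)
open import Data.List.Relation.Unary.Any using (here; there)
open import Data.List.Membership.Propositional using (_∈_)
open import Data.List.Membership.Propositional.Properties using (∈-allFin)
open import Data.Product using (Σ; ∃; _×_; _,_; proj₁; proj₂)
open import Data.Sum using (_⊎_; inj₁; inj₂; [_,_]′)
open import Data.Empty using (⊥; ⊥-elim)
open import Data.Unit using (⊤; tt)
open import Function using (_∘_; id)
open import Function.Bundles using (_⇔_; mk⇔)
open import Function.Construct.Composition using (_⇔-∘_)
open import Function.Construct.Symmetry using (⇔-sym)
open import Relation.Binary.PropositionalEquality
open import Relation.Nullary using (Dec; yes; no; ¬_; does)
open import Relation.Nullary.Decidable using (_×-dec_; _→-dec_; ¬?; decidable-stable)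
open import Relation.Unary using (Decidable)

true≢false : true ≢ false
true≢false ()

∧-false : ∀ x y → x ∧ y ≡ false → x ≡ false ⊎ y ≡ false
∧-false false _ _ = inj₁ refl
∧-false true  _ e = inj₂ e

∨-true : ∀ x y → x ∨ y ≡ true → x ≡ true ⊎ y ≡ true
∨-true true  _ _ = inj₁ refl
∨-true false _ e = inj₂ e

not-true : ∀ {x} → not x ≡ true → x ≡ false
not-true {false} _ = refl

EQ-holds : ∀ {x y} → x ≡ y → not (x B.xor y) ≡ true
EQ-holds {false} refl = refl
EQ-holds {true}  refl = refl

EQ-equates : ∀ x y → not (x B.xor y) ≡ true → x ≡ y
EQ-equates false false _ = refl
EQ-equates true  true  _ = refl

EQ-fails : ∀ {x y} → x ≡ true → y ≡ false → not (x B.xor y) ≡ false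
EQ-fails refl refl = refl

≤-false : ∀ {x y} → x B.≤ y → y ≡ false → x ≡ false
≤-false B.b≤b refl = refl

≤-strict : ∀ {x y} → x B.≤ y → y ≢ x → x ≡ false × y ≡ true
≤-strict B.f≤t _ = refl , refl
≤-strict B.b≤b y≢x = ⊥-elim (y≢x refl)

OR-zeros : ∀ m (a : Vector Bool m) → OR m a ≡ false → ∀ p → a p ≡ false
OR-zeros (suc m) a e zero    with a zero | e
... | false | _ = refl
OR-zeros (suc m) a e (suc p) with a zero | e
... | false | e′ = OR-zeros m (tail a) e′ p

OR-hit : ∀ m (a : Vector Bool m) → OR m a ≡ true → ∃ λ p → a p ≡ true
OR-hit (suc m) a e with ∨-true (a zero) _ e
... | inj₁ a₀ = zero , a₀
... | inj₂ rest = let p , ap = OR-hit m (tail a) rest in suc p , ap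

OR-intro : ∀ m (a : Vector Bool m) p → a p ≡ true → OR m a ≡ true
OR-intro (suc m) a zero    ap rewrite ap = refl
OR-intro (suc m) a (suc p) ap with a zero
... | true  = refl
... | false = OR-intro m (tail a) p ap

OR-none : ∀ m (a : Vector Bool m) → (∀ p → a p ≡ false) → OR m a ≡ false
OR-none zero    a _ = refl
OR-none (suc m) a h rewrite h zero = OR-none m (tail a) (h ∘ suc)

≤t-refl : ∀ {n} {a : Vector Bool n} → a ≤t a
≤t-refl _ = BP.≤-refl

≤t-trans : ∀ {n} {a b c : Vector Bool n} → a ≤t b → b ≤t c → a ≤t c
≤t-trans a≤b b≤c i = BP.≤-trans (a≤b i) (b≤c i)

∷-cong : ∀ {n} b {a a′ : Vector Bool n} → a ≗ a′ → (b ∷ a) ≗ (b ∷ a′)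
∷-cong b a≗a′ zero    = refl
∷-cong b a≗a′ (suc i) = a≗a′ i

∷-η : ∀ {n} (a : Vector Bool (suc n)) → a ≗ (head a ∷ tail a)
∷-η a zero    = refl
∷-η a (suc i) = refl

≗-∷ : ∀ {n} {a : Vector Bool (suc n)} {b a′} → head a ≡ b → a′ ≗ tail a → (b ∷ a′) ≗ a
≗-∷ a₀ a′≗ zero    = sym a₀
≗-∷ a₀ a′≗ (suc i) = a′≗ i

-- the number of zeros, which strictly decreases when a tuple is raised
zeros : ∀ {n} → Vector Bool n → ℕ
zeros {zero}  _ = 0
zeros {suc n} a = (if head a then 0 else 1) + zeros (tail a)

bit-anti : ∀ {x y} → x B.≤ y → (if y then 0 else 1) ≤ (if x then 0 else 1)
bit-anti B.f≤t = z≤n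
bit-anti {false} B.b≤b = s≤s z≤n
bit-anti {true}  B.b≤b = z≤n

zeros-anti : ∀ {n} {a b : Vector Bool n} → a ≤t b → zeros b ≤ zeros a
zeros-anti {zero}  _   = z≤n
zeros-anti {suc n} a≤b = +-mono-≤ (bit-anti (a≤b zero)) (zeros-anti (a≤b ∘ suc))

zeros-strict : ∀ {n} {a b : Vector Bool n} → a ≤t b → ∀ i → a i ≡ false → b i ≡ true → zeros b < zeros a
zeros-strict a≤b zero a₀ b₀ rewrite a₀ | b₀ = +-mono-<-≤ (s≤s z≤n) (zeros-anti (a≤b ∘ suc))
zeros-strict a≤b (suc i) aᵢ bᵢ = +-mono-≤-< (bit-anti (a≤b zero)) (zeros-strict (a≤b ∘ suc) i aᵢ bᵢ)

Respects≗ : ∀ {n} → (Vector Bool n → Set) → Set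
Respects≗ P = ∀ {a b} → a ≗ b → P a → P b

search : ∀ {n} (P : Vector Bool n → Set) → Respects≗ P → Decidable P → ∃ P ⊎ (∀ a → ¬ P a)
search {zero} P resp P? with P? []
... | yes p = inj₁ ([] , p)
... | no ¬p = inj₂ (λ a pa → ¬p (resp (λ ()) pa))
search {suc n} P resp P? with search (P ∘ (false ∷_)) (resp ∘ ∷-cong false) (P? ∘ (false ∷_))
                            | search (P ∘ (true ∷_)) (resp ∘ ∷-cong true) (P? ∘ (true ∷_))
... | inj₁ (a , p) | _ = inj₁ (false ∷ a , p)
... | inj₂ _ | inj₁ (a , p) = inj₁ (true ∷ a , p)
... | inj₂ none₀ | inj₂ none₁ = inj₂ (λ a pa → split a (resp (∷-η a) pa))
  where split : ∀ a → ¬ P (head a ∷ tail a)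
        split a with head a
        ... | false = none₀ (tail a)
        ... | true  = none₁ (tail a)

decide∃ : ∀ {n} (P : Vector Bool n → Set) → Respects≗ P → Decidable P → Dec (∃ P)
decide∃ P resp P? with search P resp P?
... | inj₁ found = yes found
... | inj₂ none  = no (λ (a , pa) → none a pa)

decide∀ : ∀ {n} (P : Vector Bool n → Set) → Respects≗ P → Decidable P → Dec (∀ a → P a)
decide∀ P resp P? with search (¬_ ∘ P) (λ a≗b ¬pa pb → ¬pa (resp (sym ∘ a≗b) pb)) (¬? ∘ P?)
... | inj₁ (a , ¬pa) = no (λ all → ¬pa (all a))
... | inj₂ none      = yes (λ a → decidable-stable (P? a) (none a))

module _ {n} {R : BRel n} where

  ∼-sym : ∀ {i j} → i ∼[ R ] j → j ∼[ R ] i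
  ∼-sym i∼j a a∈R = sym (i∼j a a∈R)

  ∼-trans : ∀ {i j k} → i ∼[ R ] j → j ∼[ R ] k → i ∼[ R ] k
  ∼-trans i∼j j∼k a a∈R = trans (i∼j a a∈R) (j∼k a a∈R)

  outside-O : ∀ {i} → ¬ InO R i → ∀ c → c ∈R R → c i ≡ false
  outside-O {i} i∉O c c∈R with c i in cᵢ
  ... | false = refl
  ... | true  = ⊥-elim (i∉O (c , c∈R , cᵢ))

  vanishing⇒outside-O : ∀ {i} → (∀ c → c ∈R R → c i ≡ false) → ¬ InO R i
  vanishing⇒outside-O vanish (b , b∈R , bᵢ) = true≢false (trans (sym bᵢ) (vanish b b∈R))

  O-∼ : ∀ {i j} → i ∼[ R ] j → InO R j → InO R i
  O-∼ i∼j (b , b∈R , bⱼ) = b , b∈R , trans (i∼j b b∈R) bⱼ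

  conforming-≗ : ∀ {a b} → a ≗ b → Conforming R a → Conforming R b
  conforming-≗ a≗b (equates , vanishes) =
    (λ i j i∼j → trans (sym (a≗b i)) (trans (equates i j i∼j) (a≗b j))) ,
    (λ i i∉O → trans (sym (a≗b i)) (vanishes i i∉O))

  member-conforming : ∀ {a} → a ∈R R → Conforming R a
  member-conforming a∈R = (λ i j i∼j → i∼j _ a∈R) , (λ i i∉O → outside-O i∉O _ a∈R)

Extensional : ∀ {n} → BRel n → Set
Extensional R = ∀ {a b} → a ≗ b → a ∈R R → b ∈R R

-- The filter property forces extensionality: b ≗ a is conforming and above a.
filter⇒extensional : ∀ {n} {R : BRel n} → FilterProperty R → Extensional R
filter⇒extensional filter {a} {b} a≗b a∈R =
  filter a b a∈R (conforming-≗ a≗b (member-conforming a∈R)) (λ i → BP.≤-reflexive (a≗b i))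

Satisfies : ∀ {n k} → Vector Bool n → (Fin k → Fin n) → Set
Satisfies c f = ∃ λ p → c (f p) ≡ true

record ViolatedClause {n} (Ok : ℕ → Set) (R : BRel n) (a : Vector Bool n) : Set where
  constructor violated
  field
    size      : ℕ
    pos       : Fin size → Fin n
    allowed   : Ok size
    fails     : ∀ p → a (pos p) ≡ false
    satisfied : ∀ c → c ∈R R → Satisfies c pos

data Refutation {n} (Ok : ℕ → Set) (R : BRel n) (a : Vector Bool n) : Set where
  equality : (i j : Fin n) → a i ≡ true → a j ≡ false → i ∼[ R ] j → Refutation Ok R a
  constant : (i : Fin n) → a i ≡ true → (∀ c → c ∈R R → c i ≡ false) → Refutation Ok R a
  clause   : ViolatedClause Ok R a → Refutation Ok R a

Refutable : (Ok : ℕ → Set) → ∀ {n} → BRel n → Set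
Refutable Ok R = ∀ a → R a ≡ false → Refutation Ok R a

-- the clause sizes of IS₁₂ and of IS₁₂^r
AnySize : ℕ → Set
AnySize _ = ⊤

AtMost : ℕ → ℕ → Set
AtMost r k = k ≤ r

pull : ∀ {Ok m n} {R : BRel m} {S : BRel n} {a′ a} (σ : Fin m → Fin n) →
       a′ ≗ a ∘ σ → (∀ c → c ∈R S → ∃ λ c′ → c′ ∈R R × c′ ≗ c ∘ σ) →
       Refutation Ok R a′ → Refutation Ok S a
pull σ a′≗ restricts (equality i j a′ᵢ a′ⱼ i∼j) =
  equality (σ i) (σ j) (trans (sym (a′≗ i)) a′ᵢ) (trans (sym (a′≗ j)) a′ⱼ) σi∼σj
  where σi∼σj : σ i ∼[ _ ] σ j
        σi∼σj c c∈S = let c′ , c′∈R , c′≗ = restricts c c∈S in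
                      trans (sym (c′≗ i)) (trans (i∼j c′ c′∈R) (c′≗ j))
pull σ a′≗ restricts (constant i a′ᵢ vanish) =
  constant (σ i) (trans (sym (a′≗ i)) a′ᵢ)
    (λ c c∈S → let c′ , c′∈R , c′≗ = restricts c c∈S in trans (sym (c′≗ i)) (vanish c′ c′∈R))
pull σ a′≗ restricts (clause (violated k f ok fails sat)) =
  clause (violated k (σ ∘ f) ok (λ p → trans (sym (a′≗ (f p))) (fails p))
    (λ c c∈S → let c′ , c′∈R , c′≗ = restricts c c∈S ; p , c′p = sat c′ c′∈R in
               p , trans (sym (c′≗ (f p))) c′p))

restrict : ∀ {Ok n} {R S : BRel n} {a} → (∀ c → c ∈R S → c ∈R R) → Refutation Ok R a → Refutation Ok S a
restrict S⊆R = pull id (λ _ → refl) (λ c c∈S → c , S⊆R c c∈S , λ _ → refl)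

conforming-clause : ∀ {Ok n} {R : BRel n} {a} → Conforming R a → Refutation Ok R a → ViolatedClause Ok R a
conforming-clause _ (clause cl) = cl
conforming-clause (equates , _) (equality i j aᵢ aⱼ i∼j) =
  ⊥-elim (true≢false (trans (sym aᵢ) (trans (equates i j i∼j) aⱼ)))
conforming-clause (_ , vanishes) (constant i aᵢ vanish) =
  ⊥-elim (true≢false (trans (sym aᵢ) (vanishes i (vanishing⇒outside-O vanish))))

violated-below : ∀ {Ok n} {R : BRel n} {a b} → ViolatedClause Ok R a → b ≤t a → ViolatedClause Ok R b
violated-below (violated k f ok fails sat) b≤a = violated k f ok (λ p → ≤-false (b≤a (f p)) (fails p)) sat

violated-excludes : ∀ {Ok n} {R : BRel n} {a b} → ViolatedClause Ok R a → b ≤t a → ¬ b ∈R R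
violated-excludes cl b≤a b∈R =
  let violated _ f _ fails sat = violated-below cl b≤a ; p , bp = sat _ b∈R in
  true≢false (trans (sym bp) (fails p))

-- (1) Refutable relations have the filter properties

refutable⇒filter : ∀ {Ok n} {R : BRel n} → Refutable Ok R → FilterProperty R
refutable⇒filter {R = R} refutable a a′ a∈R conf a≤a′ with R a′ in e
... | true  = refl
... | false = ⊥-elim (violated-excludes (conforming-clause conf (refutable a′ e)) a≤a′ a∈R)

refutable⇒extensional : ∀ {Ok n} {R : BRel n} → Refutable Ok R → Extensional R
refutable⇒extensional = filter⇒extensional ∘ refutable⇒filter

module Decidability {n} {R : BRel n} (extensional : Extensional R) where

  nonmember-≗ : ∀ {a b} → a ≗ b → R a ≡ false → R b ≡ false
  nonmember-≗ {a} {b} a≗b Ra with R b in e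
  ... | false = refl
  ... | true  = ⊥-elim (true≢false (trans (sym (extensional (sym ∘ a≗b) e)) Ra))

  _∼?_ : ∀ i j → Dec (i ∼[ R ] j)
  i ∼? j = decide∀ (λ a → a ∈R R → a i ≡ a j)
             (λ a≗b h b∈R → trans (sym (a≗b i)) (trans (h (extensional (sym ∘ a≗b) b∈R)) (a≗b j)))
             (λ a → (R a B.≟ true) →-dec (a i B.≟ a j))

  O? : ∀ i → Dec (InO R i)
  O? i = decide∃ (λ b → b ∈R R × b i ≡ true)
           (λ a≗b (a∈R , aᵢ) → extensional a≗b a∈R , trans (sym (a≗b i)) aᵢ)
           (λ b → (R b B.≟ true) ×-dec (b i B.≟ true))

  conforming? : ∀ a → Dec (Conforming R a)
  conforming? a = all? (λ i → all? (λ j → (i ∼? j) →-dec (a i B.≟ a j)))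
            ×-dec all? (λ i → ¬? (O? i) →-dec (a i B.≟ false))

-- A maximal non-member m of a relation refutable with clauses of size ≤ r
-- has at most r zero classes: raising m on any zero class in O_R yields a
-- member, which must satisfy the refuting clause inside that class.
module MaximalNonMembers {n} {R : BRel n} {r} (refutable : Refutable (AtMost r) R) where
  open Decidability (refutable⇒extensional refutable)

  raise : Vector Bool n → Fin n → Vector Bool n
  raise m j x = m x ∨ does (x ∼? j)

  raise-at : ∀ m j → raise m j j ≡ true
  raise-at m j with m j | j ∼? j
  ... | true  | _     = refl
  ... | false | yes _ = refl
  ... | false | no j≁j = ⊥-elim (j≁j (λ _ _ → refl))

  raise-above : ∀ m j → m ≤t raise m j
  raise-above m j x with m x
  ... | true  = B.b≤b
  ... | false = BP.≤-minimum _

  raise-new : ∀ m j x → m x ≡ false → raise m j x ≡ true → x ∼[ R ] j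
  raise-new m j x mₓ raised with m x | x ∼? j
  raise-new m j x mₓ raised | false | yes x∼j = x∼j
  raise-new m j x mₓ ()     | false | no _

  raise-conforming : ∀ m j → Conforming R m → InO R j → Conforming R (raise m j)
  raise-conforming m j (equates , vanishes) j∈O = equates′ , vanishes′
    where
      equates′ : ∀ x y → x ∼[ R ] y → raise m j x ≡ raise m j y
      equates′ x y x∼y with x ∼? j | y ∼? j
      ... | yes _   | yes _   = cong (_∨ true) (equates x y x∼y)
      ... | no _    | no _    = cong (_∨ false) (equates x y x∼y)
      ... | yes x∼j | no y≁j  = ⊥-elim (y≁j (∼-trans (∼-sym x∼y) x∼j))
      ... | no x≁j  | yes y∼j = ⊥-elim (x≁j (∼-trans x∼y y∼j))
      vanishes′ : ∀ x → ¬ InO R x → raise m j x ≡ false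
      vanishes′ x x∉O with x ∼? j
      ... | yes x∼j = ⊥-elim (x∉O (O-∼ x∼j j∈O))
      ... | no _    = trans (BP.∨-identityʳ (m x)) (vanishes x x∉O)

  few-zero-classes : ∀ m → MaximalNonMember R m → ZeroClassesAtMost r R m
  few-zero-classes m (conf , Rm , maximal) k g distinct g∈O g-zero =
    ≤-trans (injective⇒≤ hit-injective) k≤r
    where
      open ViolatedClause (conforming-clause conf (refutable m Rm)) renaming (allowed to k≤r)
      -- raising m on the class of g p gives a conforming tuple above m and
      -- different at g p, hence a member by maximality
      raised : ∀ p → raise m (g p) ∈R R
      raised p with R (raise m (g p)) in e
      ... | true  = refl
      ... | false = ⊥-elim (true≢false (trans (sym (raise-at m (g p)))
                      (trans (maximal _ (raise-conforming m (g p) conf (g∈O p)) e (raise-above m (g p)) (g p))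
                             (g-zero p))))
      -- it satisfies the clause at a coordinate of that class, distinct
      -- classes giving distinct coordinates
      hit : Fin k → Fin size
      hit p = proj₁ (satisfied _ (raised p))
      hit∼ : ∀ p → pos (hit p) ∼[ R ] g p
      hit∼ p = raise-new m (g p) (pos (hit p)) (fails (hit p)) (proj₂ (satisfied _ (raised p)))
      hit-injective : ∀ {p q} → hit p ≡ hit q → p ≡ q
      hit-injective {p} {q} same with p Fin.≟ q
      ... | yes p≡q = p≡q
      ... | no p≢q  = ⊥-elim (distinct p q p≢q
                        (∼-trans (∼-sym (hit∼ p)) (subst (λ t → pos t ∼[ R ] g q) (sym same) (hit∼ q))))

refutable⇒rfilter : ∀ {n} {R : BRel n} {r} → Refutable (AtMost r) R → rFilterProperty r R
refutable⇒rfilter refutable = refutable⇒filter refutable , MaximalNonMembers.few-zero-classes refutable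

-- (2) The filter properties yield refutations

module FilterRefutations {n} {R : BRel n} (filter : FilterProperty R) where
  open Decidability (filter⇒extensional filter)

  nonconformity : ∀ {Ok} a → Refutation Ok R a ⊎ Conforming R a
  nonconformity a with any? (λ i → any? (λ j → (i ∼? j) ×-dec (a i B.≟ true) ×-dec (a j B.≟ false)))
                     | any? (λ i → ¬? (O? i) ×-dec (a i B.≟ true))
  ... | yes (i , j , i∼j , aᵢ , aⱼ) | _ = inj₁ (equality i j aᵢ aⱼ i∼j)
  ... | no _ | yes (i , i∉O , aᵢ) = inj₁ (constant i aᵢ (outside-O i∉O))
  ... | no no-split | no no-one = inj₂ (equates , vanishes)
    where
      equates : ∀ i j → i ∼[ R ] j → a i ≡ a j
      equates i j i∼j with a i in aᵢ | a j in aⱼ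
      ... | false | false = refl
      ... | true  | true  = refl
      ... | true  | false = ⊥-elim (no-split (i , j , i∼j , aᵢ , aⱼ))
      ... | false | true  = ⊥-elim (no-split (j , i , ∼-sym i∼j , aⱼ , aᵢ))
      vanishes : ∀ i → ¬ InO R i → a i ≡ false
      vanishes i i∉O with a i in aᵢ
      ... | false = refl
      ... | true  = ⊥-elim (no-one (i , i∉O , aᵢ))

  record ZeroClasses (m : Vector Bool n) (L : List (Fin n)) : Set where
    field
      count    : ℕ
      rep      : Fin count → Fin n
      distinct : ∀ p q → p ≢ q → ¬ rep p ∼[ R ] rep q
      rep-zero : ∀ p → m (rep p) ≡ false
      rep-in-O : ∀ p → InO R (rep p)
      covers   : ∀ i → i ∈ L → m i ≡ false → InO R i → ∃ λ p → rep p ∼[ R ] i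

  zeroClasses : ∀ m L → ZeroClasses m L
  zeroClasses m []ᴸ = record
    { count = 0 ; rep = λ () ; distinct = λ () ; rep-zero = λ () ; rep-in-O = λ () ; covers = λ _ () }
  zeroClasses m (i ∷ᴸ L) = extend (zeroClasses m L)
    where
      keep : (Z : ZeroClasses m L) → (m i ≡ false → InO R i → ∃ λ p → ZeroClasses.rep Z p ∼[ R ] i) →
             ZeroClasses m (i ∷ᴸ L)
      keep Z covers-i = record
        { count = count ; rep = rep ; distinct = distinct ; rep-zero = rep-zero ; rep-in-O = rep-in-O
        ; covers = λ { _ (here refl) → covers-i ; j (there j∈L) → covers j j∈L } }
        where open ZeroClasses Z
      extend : ZeroClasses m L → ZeroClasses m (i ∷ᴸ L)
      extend Z with any? (λ p → ZeroClasses.rep Z p ∼? i) | m i B.≟ false | O? i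
      ... | yes found | _ | _ = keep Z (λ _ _ → found)
      ... | no _ | no mᵢ≢0 | _ = keep Z (λ mᵢ≡0 _ → ⊥-elim (mᵢ≢0 mᵢ≡0))
      ... | no _ | yes _ | no i∉O = keep Z (λ _ i∈O → ⊥-elim (i∉O i∈O))
      ... | no new | yes mᵢ≡0 | yes i∈O = record
        { count = suc count ; rep = i ∷ rep ; distinct = distinct′
        ; rep-zero = λ { zero → mᵢ≡0 ; (suc p) → rep-zero p }
        ; rep-in-O = λ { zero → i∈O ; (suc p) → rep-in-O p }
        ; covers = λ { _ (here refl) _ _ → zero , λ _ _ → refl
                     ; j (there j∈L) mⱼ j∈O → let p , p∼j = covers j j∈L mⱼ j∈O in suc p , p∼j } }
        where
          open ZeroClasses Z
          distinct′ : ∀ p q → p ≢ q → ¬ (i ∷ rep) p ∼[ R ] (i ∷ rep) q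
          distinct′ zero    zero    p≢q _   = p≢q refl
          distinct′ zero    (suc q) _   i∼q = new (q , ∼-sym i∼q)
          distinct′ (suc p) zero    _   p∼i = new (p , p∼i)
          distinct′ (suc p) (suc q) p≢q   = distinct p q (p≢q ∘ cong suc)

  -- A conforming non-member m is refuted by the clause through the
  -- representatives of its zero classes: a member vanishing on all of them
  -- would lie below m, hence m would be a member by the filter property.
  zero-class-clause : ∀ {Ok m} → Conforming R m → R m ≡ false →
                      Ok (ZeroClasses.count (zeroClasses m (allFin n))) → ViolatedClause Ok R m
  zero-class-clause {Ok} {m} conf Rm ok = violated count rep ok rep-zero satisfied
    where
      open ZeroClasses (zeroClasses m (allFin n))
      satisfied : ∀ c → c ∈R R → Satisfies c rep
      satisfied c c∈R with any? (λ p → c (rep p) B.≟ true)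
      ... | yes hit = hit
      ... | no miss = ⊥-elim (true≢false (trans (sym (filter c m c∈R conf c≤m)) Rm))
        where
          c≤m : c ≤t m
          c≤m i with m i in mᵢ | c i in cᵢ
          ... | true  | _     = BP.≤-maximum _
          ... | false | false = B.b≤b
          ... | false | true  = ⊥-elim (miss (let p , p∼i = covers i (∈-allFin i) mᵢ (c , c∈R , cᵢ) in
                                               p , trans (p∼i c c∈R) cᵢ))

  filter⇒refutable : Refutable AnySize R
  filter⇒refutable a Ra with nonconformity a
  ... | inj₁ refutation = refutation
  ... | inj₂ conf       = clause (zero-class-clause conf Ra tt)

  Above : Vector Bool n → Vector Bool n → Set
  Above a a′ = Conforming R a′ × R a′ ≡ false × a ≤t a′ × ∃ λ i → a i ≡ false × a′ i ≡ true

  above? : ∀ a → Dec (∃ (Above a))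
  above? a = decide∃ (Above a) respects
    (λ a′ → conforming? a′ ×-dec (R a′ B.≟ false) ×-dec all? (λ i → a i BP.≤? a′ i)
                                ×-dec any? (λ i → (a i B.≟ false) ×-dec (a′ i B.≟ true)))
    where
      respects : Respects≗ (Above a)
      respects a′≗b (conf , Ra′ , a≤a′ , i , aᵢ , a′ᵢ) =
        conforming-≗ a′≗b conf , nonmember-≗ a′≗b Ra′ ,
        (λ j → subst (a j B.≤_) (a′≗b j) (a≤a′ j)) , i , aᵢ , trans (sym (a′≗b i)) a′ᵢ

  climb : ∀ fuel a → zeros a < fuel → Conforming R a → R a ≡ false →
          Σ (Vector Bool n) λ m → MaximalNonMember R m × a ≤t m
  climb (suc fuel) a bound conf Ra with above? a
  ... | yes (a′ , conf′ , Ra′ , a≤a′ , i , aᵢ , a′ᵢ) =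
    let m , maximal , a′≤m = climb fuel a′ (<-≤-trans (zeros-strict a≤a′ i aᵢ a′ᵢ) (s≤s⁻¹ bound)) conf′ Ra′
    in m , maximal , ≤t-trans a≤a′ a′≤m
  ... | no none = a , (conf , Ra , maximal) , ≤t-refl
    where
      maximal : ∀ a′ → Conforming R a′ → R a′ ≡ false → a ≤t a′ → ∀ i → a′ i ≡ a i
      maximal a′ conf′ Ra′ a≤a′ i with a′ i B.≟ a i
      ... | yes same = same
      ... | no differ = let aᵢ , a′ᵢ = ≤-strict (a≤a′ i) differ in
                        ⊥-elim (none (a′ , conf′ , Ra′ , a≤a′ , i , aᵢ , a′ᵢ))

  -- Under the r-filter property, refute a by the zero classes of a maximal
  -- non-member above it; there are at most r of them.
  rfilter⇒refutable : ∀ {r} → rFilterProperty r R → Refutable (AtMost r) R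
  rfilter⇒refutable (_ , few) a Ra with nonconformity a
  ... | inj₁ refutation = refutation
  ... | inj₂ conf =
    let m , maximal , a≤m = climb (suc (zeros a)) a (n<1+n _) conf Ra
        conf-m , Rm , _ = maximal
        open ZeroClasses (zeroClasses m (allFin n))
    in clause (violated-below (zero-class-clause conf-m Rm (few m maximal count rep distinct rep-in-O rep-zero)) a≤m)

-- (3) Soundness: relations of ⟨⟨Γ⟩⟩ are refutable

exists-member : ∀ {n} {R : BRel (suc n)} {c} → c ∈R exists R → ∃ λ b → (b ∷ c) ∈R R
exists-member {R = R} {c} c∈ with ∨-true (R (false ∷ c)) _ c∈
... | inj₁ h = false , h
... | inj₂ h = true , h

exists-tail : ∀ {n} {R : BRel (suc n)} (Q : Vector Bool n → Set) →
              (∀ c → c ∈R R → Q (tail c)) → ∀ c → c ∈R exists R → Q c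
exists-tail {R = R} Q h c c∈ = let b , bc∈R = exists-member {R = R} c∈ in h (b ∷ c) bc∈R

collapse : ∀ {n} → Fin n → Fin (suc n) → Fin n
collapse d zero    = d
collapse d (suc x) = x

untail : ∀ {n} {a : Vector Bool n} (x : Fin (suc n)) → (true ∷ a) x ≡ false → Fin n
untail (suc x) _ = x

suc-untail : ∀ {n} {a : Vector Bool n} x (h : (true ∷ a) x ≡ false) → suc (untail x h) ≡ x
suc-untail (suc x) _ = refl

IsSuc : ∀ {n} → Fin (suc n) → Set
IsSuc {n} x = ∃ λ (d : Fin n) → x ≡ suc d

isSuc? : ∀ {n} (x : Fin (suc n)) → Dec (IsSuc x)
isSuc? zero    = no (λ ())
isSuc? (suc x) = yes (x , refl)

-- The clause sizes Ok must cover the generators OR^m, the unit clause δ₁,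
-- and the empty clause (quantification may refute every tuple).
module Soundness (P Ok : ℕ → Set) (generator : ∀ {m} → P m → Ok m) (ok₀ : Ok 0) (ok₁ : Ok 1) where

  EQ-refutable : Refutable Ok EQ
  EQ-refutable a EQa with a zero in a₀ | a (suc zero) in a₁
  ... | true  | false = equality zero (suc zero) a₀ a₁ (λ c h → EQ-equates (c zero) _ h)
  ... | false | true  = equality (suc zero) zero a₁ a₀ (λ c h → sym (EQ-equates (c zero) _ h))
  EQ-refutable a () | true  | true
  EQ-refutable a () | false | false

  δ₀-refutable : Refutable Ok δ₀
  δ₀-refutable a δ₀a = constant zero (trans (sym (BP.not-involutive _)) (cong not δ₀a)) (λ c → not-true)

  δ₁-refutable : Refutable Ok δ₁
  δ₁-refutable a δ₁a = clause (violated 1 (λ _ → zero) ok₁ (λ _ → δ₁a) (λ c h → zero , h))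

  OR-refutable : ∀ {m} → P m → Refutable Ok (OR m)
  OR-refutable {m} pm a ORa = clause (violated m id (generator pm) (OR-zeros m a ORa) (OR-hit m))

  drop-vanishing : ∀ {n} {R : BRel (suc n)} {a} → (∀ c → c ∈R R → c zero ≡ false) →
                   Refutation Ok R (false ∷ a) → Refutation Ok (exists R) a
  drop-vanishing _ (equality (suc i) (suc j) aᵢ aⱼ i∼j) =
    equality i j aᵢ aⱼ (exists-tail (λ c → c i ≡ c j) i∼j)
  drop-vanishing y≡0 (equality (suc i) zero aᵢ _ i∼y) =
    constant i aᵢ (exists-tail (λ c → c i ≡ false) (λ c c∈R → trans (i∼y c c∈R) (y≡0 c c∈R)))
  drop-vanishing _ (constant (suc i) aᵢ vanish) = constant i aᵢ (exists-tail (λ c → c i ≡ false) vanish)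
  drop-vanishing {R = R} {a} y≡0 (clause (violated k f ok fails sat)) with any? (λ p → isSuc? (f p))
  ... | yes (p₀ , d , fp₀≡d) =
    clause (violated k (collapse d ∘ f) ok (λ p → collapse-fails (f p) (fails p))
      (exists-tail (λ c → Satisfies c (collapse d ∘ f))
        (λ c c∈R → let p , cp = sat c c∈R in p , tail-hit c (f p) (y≡0 c c∈R) cp)))
    where
      a-d : a d ≡ false
      a-d = subst (λ x → (false ∷ a) x ≡ false) fp₀≡d (fails p₀)
      collapse-fails : ∀ x → (false ∷ a) x ≡ false → a (collapse d x) ≡ false
      collapse-fails zero    _ = a-d
      collapse-fails (suc x) h = h
      tail-hit : ∀ (c : Vector Bool (suc _)) x → c zero ≡ false → c x ≡ true → c (suc (collapse d x)) ≡ true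
      tail-hit c zero    c₀ cₓ = ⊥-elim (true≢false (trans (sym cₓ) c₀))
      tail-hit c (suc x) _  cₓ = cₓ
  ... | no all-y = clause (violated 0 (λ ()) ok₀ (λ ()) (λ c c∈ → ⊥-elim (empty c c∈)))
    where
      -- a member of exists R extends to a member of R, which satisfies the
      -- clause only at y, where it vanishes
      empty : ∀ c → ¬ c ∈R exists R
      empty c c∈ with exists-member {R = R} c∈
      ... | b , bc∈R with sat (b ∷ c) bc∈R
      ... | p , hit with f p in fp
      ...   | zero  = true≢false (trans (sym hit) (y≡0 (b ∷ c) bc∈R))
      ...   | suc d = all-y (p , d , fp)

  -- Existential quantification: resolve the refutations of (0, a) and (1, a)
  -- on the quantified coordinate y.
  exists-refutable : ∀ {n} {R : BRel (suc n)} → Refutable Ok R → Refutable Ok (exists R)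
  exists-refutable {R = R} refutable a Ea =
    resolve (refutable _ (BP.∨-conicalˡ (R (false ∷ a)) (R (true ∷ a)) Ea))
            (refutable _ (BP.∨-conicalʳ (R (false ∷ a)) (R (true ∷ a)) Ea))
    where
      resolve : Refutation Ok R (false ∷ a) → Refutation Ok R (true ∷ a) → Refutation Ok (exists R) a
      -- y equals xⱼ on R: substitute y := xⱼ in the refutation of (0, a)
      resolve w₀ (equality zero (suc j) _ aⱼ y∼j) =
        pull (collapse j) (λ { zero → sym aⱼ ; (suc x) → refl })
          (λ c c∈ → let b , bc∈R = exists-member {R = R} c∈ in
                    b ∷ c , bc∈R , λ { zero → y∼j _ bc∈R ; (suc x) → refl }) w₀
      resolve w₀ (constant zero _ y≡0) = drop-vanishing y≡0 w₀
      -- otherwise the refutation of (1, a) does not involve y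
      resolve _ (equality (suc i) (suc j) aᵢ aⱼ i∼j) = equality i j aᵢ aⱼ (exists-tail (λ c → c i ≡ c j) i∼j)
      resolve _ (constant (suc i) aᵢ vanish) = constant i aᵢ (exists-tail (λ c → c i ≡ false) vanish)
      resolve _ (clause (violated k f ok fails sat)) =
        clause (violated k (λ p → untail (f p) (fails p)) ok
          (λ p → subst (λ x → (true ∷ a) x ≡ false) (sym (suc-untail (f p) (fails p))) (fails p))
          (exists-tail (λ c → Satisfies c (λ p → untail (f p) (fails p)))
            (λ c c∈R → let p , cp = sat c c∈R in
                       p , subst (λ x → c x ≡ true) (sym (suc-untail (f p) (fails p))) cp)))
      -- (1, a) is 1 at y, so y is never the 0-side of an equality
      resolve _ (equality _ zero _ () _)

  sound : ∀ {n} {R : BRel n} → Clo P R → Refutable Ok R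
  sound gen-EQ = EQ-refutable
  sound gen-δ₀ = δ₀-refutable
  sound gen-δ₁ = δ₁-refutable
  sound (gen-OR pm) = OR-refutable pm
  sound (vars σ C) a Ra = pull σ (λ _ → refl) (λ c c∈ → _ , c∈ , λ _ → refl) (sound C _ Ra)
  sound (and {R = R} {S} C D) a RSa with ∧-false (R a) (S a) RSa
  ... | inj₁ Ra = restrict (λ c → BP.∧-conicalˡ (R c) _) (sound C a Ra)
  ... | inj₂ Sa = restrict (λ c → BP.∧-conicalʳ (R c) _) (sound D a Sa)
  sound (ex C) = exists-refutable (sound C)
  sound (ext C R≐S) a Sa = restrict (λ c c∈S → trans (R≐S c) c∈S) (sound C a (trans (R≐S a) Sa))

-- (4) Completeness: refutable relations belong to ⟨⟨Γ⟩⟩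

⋀ : ∀ {n} m → (Vector Bool m → BRel n) → BRel n
⋀ zero    F = F []
⋀ (suc m) F = conj (⋀ m (F ∘ (false ∷_))) (⋀ m (F ∘ (true ∷_)))

⋀-true : ∀ {n} m (F : Vector Bool m → BRel n) c → (∀ a → F a c ≡ true) → ⋀ m F c ≡ true
⋀-true zero    F c h = h []
⋀-true (suc m) F c h rewrite ⋀-true m (F ∘ (false ∷_)) c (h ∘ (false ∷_)) = ⋀-true m (F ∘ (true ∷_)) c (h ∘ (true ∷_))

⋀-false : ∀ {n} m (F : Vector Bool m → BRel n) c a → (∀ a′ → a′ ≗ a → F a′ c ≡ false) → ⋀ m F c ≡ false
⋀-false zero    F c a h = h [] (λ ())
⋀-false (suc m) F c a h with head a in a₀
... | false = cong (_∧ ⋀ m (F ∘ (true ∷_)) c)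
                   (⋀-false m (F ∘ (false ∷_)) c (tail a) (λ a′ a′≗ → h _ (≗-∷ a₀ a′≗)))
... | true  = trans (cong (⋀ m (F ∘ (false ∷_)) c ∧_)
                          (⋀-false m (F ∘ (true ∷_)) c (tail a) (λ a′ a′≗ → h _ (≗-∷ a₀ a′≗))))
                    (BP.∧-zeroʳ _)

Clo-⋀ : ∀ {P n} m (F : Vector Bool m → BRel n) → (∀ a → Clo P (F a)) → Clo P (⋀ m F)
Clo-⋀ zero    F C = C []
Clo-⋀ (suc m) F C = and (Clo-⋀ m (F ∘ (false ∷_)) (C ∘ (false ∷_))) (Clo-⋀ m (F ∘ (true ∷_)) (C ∘ (true ∷_)))

-- Clauses of allowed size ≥ 2 must be generators; sizes 0 and 1 are built
-- from δ₀ and δ₁.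
module Completeness (P Ok : ℕ → Set) (clause-generator : ∀ {k} → Ok k → 2 ≤ k → P k) where

  -- δ₀ ∧ δ₁ is empty and EQ(y, y) is full, so projecting y away gives
  -- the empty and the full relation of every arity
  Clo-empty : ∀ {n} → Clo P {n} (λ _ → false)
  Clo-empty = ext (ex (vars (λ _ → zero) (and gen-δ₀ gen-δ₁))) (λ _ → refl)

  Clo-full : ∀ {n} → Clo P {n} (λ _ → true)
  Clo-full = ext (ex (vars (λ _ → zero) gen-EQ)) (λ _ → refl)

  Clo-clause : ∀ {n k} (f : Fin k → Fin n) → Ok k → Clo P (substVars f (OR k))
  Clo-clause {k = 0}           f _  = ext Clo-empty (λ _ → refl)
  Clo-clause {k = 1}           f _  = ext (vars f gen-δ₁) (λ c → sym (BP.∨-identityʳ _))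
  Clo-clause {k = suc (suc k)} f ok = vars f (gen-OR (clause-generator ok (s≤s (s≤s z≤n))))

  module _ {n} {R : BRel n} (refutable : Refutable Ok R) where

    constraint : ∀ {a} → Refutation Ok R a → BRel n
    constraint (equality i j _ _ _)          = substVars (i ∷ j ∷ []) EQ
    constraint (constant i _ _)              = substVars (λ _ → i) δ₀
    constraint (clause (violated k f _ _ _)) = substVars f (OR k)

    constraint-closed : ∀ {a} (w : Refutation Ok R a) → Clo P (constraint w)
    constraint-closed (equality i j _ _ _)          = vars (i ∷ j ∷ []) gen-EQ
    constraint-closed (constant i _ _)              = vars (λ _ → i) gen-δ₀
    constraint-closed (clause (violated k f ok _ _)) = Clo-clause f ok

    constraint-contains : ∀ {a} (w : Refutation Ok R a) c → c ∈R R → constraint w c ≡ true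
    constraint-contains (equality i j _ _ i∼j) c c∈R = EQ-holds (i∼j c c∈R)
    constraint-contains (constant i _ vanish) c c∈R = cong not (vanish c c∈R)
    constraint-contains (clause (violated k f _ _ sat)) c c∈R =
      let p , cp = sat c c∈R in OR-intro k (c ∘ f) p cp

    constraint-excludes : ∀ {a} (w : Refutation Ok R a) c → a ≗ c → constraint w c ≡ false
    constraint-excludes (equality i j aᵢ aⱼ _) c a≗c = EQ-fails (trans (sym (a≗c i)) aᵢ) (trans (sym (a≗c j)) aⱼ)
    constraint-excludes (constant i aᵢ _) c a≗c = cong not (trans (sym (a≗c i)) aᵢ)
    constraint-excludes (clause (violated k f _ fails _)) c a≗c =
      OR-none k (c ∘ f) (λ p → trans (sym (a≗c (f p))) (fails p))

    verdict : ∀ a → a ∈R R ⊎ Refutation Ok R a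
    verdict a with R a in e
    ... | true  = inj₁ refl
    ... | false = inj₂ (refutable a e)

    separator : Vector Bool n → BRel n
    separator a = [ (λ _ _ → true) , constraint ]′ (verdict a)

    separator-closed : ∀ a → Clo P (separator a)
    separator-closed a with verdict a
    ... | inj₁ _ = Clo-full
    ... | inj₂ w = constraint-closed w

    separator-contains : ∀ a c → c ∈R R → separator a c ≡ true
    separator-contains a c c∈R with verdict a
    ... | inj₁ _ = refl
    ... | inj₂ w = constraint-contains w c c∈R

    separator-excludes : ∀ a c → a ≗ c → R c ≡ false → separator a c ≡ false
    separator-excludes a c a≗c Rc with verdict a
    ... | inj₁ a∈R = ⊥-elim (true≢false (trans (sym (refutable⇒extensional refutable a≗c a∈R)) Rc))
    ... | inj₂ w   = constraint-excludes w c a≗c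

    complete : Clo P R
    complete = ext (Clo-⋀ n separator separator-closed) same
      where
        same : ∀ c → ⋀ n separator c ≡ R c
        same c with R c in e
        ... | true  = ⋀-true n separator c (λ a → separator-contains a c e)
        ... | false = ⋀-false n separator c c (λ a a≗c → separator-excludes a c a≗c e)

IS12⇔refutable : ∀ {n} {R : BRel n} → IS12 R ⇔ Refutable AnySize R
IS12⇔refutable = mk⇔ (Soundness.sound _ AnySize _ tt tt) (Completeness.complete _ AnySize (λ _ 2≤k → 2≤k))

IS12^⇔refutable : ∀ {r n} {R : BRel n} → 2 ≤ r → IS12^ r R ⇔ Refutable (AtMost r) R
IS12^⇔refutable 2≤r =
  mk⇔ (Soundness.sound _ (AtMost _) proj₂ z≤n (≤-trans (s≤s z≤n) 2≤r))
      (Completeness.complete _ (AtMost _) (λ k≤r 2≤k → 2≤k , k≤r))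

filter⇔refutable : ∀ {n} {R : BRel n} → FilterProperty R ⇔ Refutable AnySize R
filter⇔refutable = mk⇔ FilterRefutations.filter⇒refutable refutable⇒filter

rfilter⇔refutable : ∀ {r n} {R : BRel n} → rFilterProperty r R ⇔ Refutable (AtMost r) R
rfilter⇔refutable = mk⇔ (λ rf → FilterRefutations.rfilter⇒refutable (proj₁ rf) rf) refutable⇒rfilter

lemma25 : ((n : ℕ) (R : BRel n) → IS12 R ⇔ FilterProperty R)
        × ((r : ℕ) → 2 ≤ r → (n : ℕ) (R : BRel n) → IS12^ r R ⇔ rFilterProperty r R)
lemma25 = (λ n R → ⇔-sym filter⇔refutable ⇔-∘ IS12⇔refutable)
        , (λ r 2≤r n R → ⇔-sym rfilter⇔refutable ⇔-∘ IS12^⇔refutable 2≤r)
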